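{- Let $D$ be a complete structured DNNF structured by a v-tree $T$ computing a Boolean function $f$ in variables $X$. Let $t$ be a node of $T$, and let $Y:= \mathsf{var}(T_t)$ and $Z=X\setminus \mathsf{var}(T_t)$. Then $\log(\mathsf{wi}(D)) \ge \mathsf{cc}(f, (Y,Z))$.
   Context: Logarithms are base 2. A v-tree for a finite variable set $X$ is a full binary rooted tree whose leaves are in bijection with $X$; for a node $t$, $T_t$ is the subtree rooted at $t$ and $\mathsf{var}(T_t)$ is the set of variables labelling its leaves. A complete structured DNNF $D$ structured by $T$ is a Boolean circuit whose input gates are literals $x$ or $\neg x$ (no constants), whose $\land$-gates have exactly two inputs and whose $\lor$-gates have arbitrary fan-in, together with a labeling $\mu$ of nodes of $T$ by sets of gates such that: every gate $g$ lies in $\mu(t_g)$ for a unique node $t_g$; if $t$ is a leaf labelled $x$ then $\mu(t)\subseteq\{x,\neg x\}$, and every input gate lies in $\mu$ of a leaf; every input of an $\lor$-gate $g$ is an $\land$-gate in $\mu(t_g)$; every $\land$-gate $g$ has two inputs $g_1,g_2$, each an $\lor$-gate or input gate, with $t_{g_1},t_{g_2}$ the two children of $t_g$. The width $\mathsf{wi}(D)$ is the maximum number of $\lor$-gates in one set $\mu(t)$. For a partition $\Pi=(Y,Z)$ of $X$, a rectangle cover of $f$ of size $s$ respecting $\Pi$ is a representation $f=\bigvee_{i=1}^s r_1^i(Y)\land r_2^i(Z)$ with arbitrary Boolean functions $r_1^i$ on $Y$ and $r_2^i$ on $Z$; $\mathsf{cc}(f,\Pi)$ is $\log$ of the minimum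 size of such a cover. -}

module Defs where

open import Data.Nat using (ℕ; _⊔_)
open import Data.Fin using (Fin)
open import Data.Bool using (Bool; true; false; not; _∧_; if_then_else_; T)
open import Data.List using (List; []; _∷_; _++_; allFin)
open import Data.Bool.ListAction using (any)
open import Data.List.Membership.Propositional using (_∈_)
open import Data.Product using (Σ; _×_; _,_; proj₁; proj₂)
open import Data.Unit using (⊤)
open import Data.Empty using (⊥)
open import Relation.Binary.PropositionalEquality using (_≡_)

Assignment : ℕ → Set
Assignment n = Fin n → Bool

BoolFun : ℕ → Set
BoolFun n = Assignment n → Bool

data VTree (n : ℕ) : Set where
  leaf : Fin n → VTree n
  node : VTree n → VTree n → VTree n

vars : ∀ {n} → VTree n → List (Fin n)
vars (leaf x)   = x ∷ []
vars (node l r) = vars l ++ vars r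

-- Nodes of a v-tree, as positions (paths from the root).
data Pos {n : ℕ} : VTree n → Set where
  here  : ∀ {t} → Pos t
  left  : ∀ {l r} → Pos l → Pos (node l r)
  right : ∀ {l r} → Pos r → Pos (node l r)

subtree : ∀ {n} {t : VTree n} → Pos t → VTree n
subtree {t = t} here = t
subtree (left p)  = subtree p
subtree (right p) = subtree p

Internal : ∀ {n} → VTree n → Set
Internal (leaf _)   = ⊥
Internal (node _ _) = ⊤

-- A circuit is given node by node (this is the labeling μ):
--  * at a leaf labelled x, μ(leaf) ⊆ {x, ¬x}: two flags saying whether
--    the literal gate x (resp. ¬x) is present;
--  * at an internal node t with children l, r: `na` ∧-gates and `no`
--    ∨-gates; ∧-gate i has one input among the "top" gates of the left
--    child and one among those of the right child (top gates = ∨-gates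
--    at an internal node, literal gates at a leaf); ∨-gate j has as
--    inputs an (arbitrary fan-in) list of ∧-gates at t.

-- literal gates at a leaf: (true , _) is x, (false , _) is ¬x
LitGate : Bool → Bool → Set
LitGate p q = Σ Bool (λ b → T (if b then p else q))

mutual
  data Circ {n : ℕ} : VTree n → Set where
    lf : (x : Fin n) (hasPos hasNeg : Bool) → Circ (leaf x)
    nd : ∀ {l r} (cl : Circ l) (cr : Circ r) (na no : ℕ)
         (andIn : Fin na → Top cl × Top cr)
         (orIn : Fin no → List (Fin na)) → Circ (node l r)

  -- gates of μ(t) that may feed an ∧-gate of the parent node
  Top : ∀ {n} {t : VTree n} → Circ t → Set
  Top (lf x p q)            = LitGate p q
  Top (nd cl cr na no a o)  = Fin no

eval : ∀ {n} {t : VTree n} (C : Circ t) → Assignment n → Top C → Bool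
eval (lf x p q) a (b , _) = if b then a x else not (a x)
eval (nd cl cr na no andIn orIn) a g =
  any (λ i → eval cl a (proj₁ (andIn i)) ∧ eval cr a (proj₂ (andIn i))) (orIn g)

IsOr : ∀ {n} {t : VTree n} (C : Circ t) → Top C → Set
IsOr (lf _ _ _) _         = ⊥
IsOr (nd _ _ _ _ _ _) _   = ⊤

width : ∀ {n} {t : VTree n} → Circ t → ℕ
width (lf _ _ _)               = 0
width (nd cl cr na no _ _)     = no ⊔ (width cl ⊔ width cr)

DependsOnly : ∀ {n} → (Fin n → Set) → BoolFun n → Set
DependsOnly {n} S g = ∀ (a a' : Assignment n) → (∀ x → S x → a x ≡ a' x) → g a ≡ g a'

Compl : ∀ {n} → (Fin n → Set) → (Fin n → Set)
Compl S x = S x → ⊥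

record RectCover {n : ℕ} (f : BoolFun n) (Y : Fin n → Set) (s : ℕ) : Set where
  field
    r₁ r₂   : Fin s → BoolFun n
    r₁-onY  : ∀ i → DependsOnly Y (r₁ i)
    r₂-onZ  : ∀ i → DependsOnly (Compl Y) (r₂ i)
    covers  : ∀ (a : Assignment n) → f a ≡ any (λ i → r₁ i a ∧ r₂ i a) (allFin s)

VarsAt : ∀ {n} {t : VTree n} → Pos t → Fin n → Set
VarsAt p x = x ∈ vars (subtree p)

{-# OPTIONS --safe #-}
module Submission where

-- Let g₁, …, g_k be the ∨-gates at node t, so k ≤ wi(D). Every path from the output
-- into the part of D below t passes through some gᵢ, hence f = ⋁ᵢ gᵢ ∧ cᵢ, where cᵢ is
-- what the output computes once gᵢ is replaced by 1 and the other gates at t by 0.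
-- Each gᵢ reads only variables of Y = var(T_t). Each cᵢ reads only gates outside the
-- part of D below t, and these see only variables of sibling subtrees of the path to t;
-- as every variable labels exactly one leaf of T, those variables lie in Z.

open import Defs
open import Algebra.Bundles using (CommutativeMonoid)
open import Data.Nat using (ℕ; _≤_; z≤n)
open import Data.Nat.Properties using (m≤m⊔n; m≤n⇒m≤n⊔o; m≤n⇒m≤o⊔n)
open import Data.Fin using (Fin)
open import Data.Fin.Properties using (_≟_)
open import Data.Bool using (Bool; true; false; not; _∧_; _∨_; T)
open import Data.Bool.Properties
  using (∧-assoc; ∧-comm; ∧-zeroʳ; ∧-distribˡ-∨; ∧-distribʳ-∨; ∨-commutativeMonoid; T-∧; T-≡; ⇔→≡)
open import Algebra.Properties.CommutativeSemigroup
  (CommutativeMonoid.commutativeSemigroup ∨-commutativeMonoid) using (interchange)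
open import Data.Bool.ListAction using (or; any)
open import Data.List using (List; []; _∷_; _++_; allFin)
open import Data.List.Properties using (map-cong)
open import Data.List.Membership.Propositional using (_∈_)
open import Data.List.Membership.Propositional.Properties using (∈-++⁺ˡ; ∈-++⁺ʳ; ∈-allFin)
open import Data.List.Relation.Binary.Subset.Propositional using (_⊆_)
open import Data.List.Relation.Binary.Disjoint.Propositional using (Disjoint)
open import Data.List.Relation.Unary.Any as Any using (here; there)
open import Data.List.Relation.Unary.Any.Properties using (any⁺; any⁻)
import Data.List.Relation.Unary.All.Properties as All
open import Data.List.Relation.Unary.All using (lookup)
open import Data.List.Relation.Unary.AllPairs using (_∷_; [])
open import Data.List.Relation.Unary.Unique.Propositional using (Unique)
open import Data.List.Relation.Unary.Unique.Propositional.Properties using (allFin⁺)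
open import Data.List.Relation.Binary.Permutation.Propositional using (_↭_; ↭-sym; ↭⇒↭ₛ)
import Data.List.Relation.Binary.Permutation.Setoid.Properties as Permutation
open import Data.Product using (∃-syntax; _×_; _,_; proj₁; proj₂)
open import Function using (id; _∘_; _⇔_; mk⇔; Equivalence)
import Function.Properties.Equivalence as ⇔
open import Relation.Nullary.Decidable using (⌊_⌋; toWitness; fromWitness)
open import Relation.Binary.Definitions using (DecidableEquality)
open import Relation.Binary.PropositionalEquality
  using (_≡_; refl; sym; trans; cong; cong₂; subst; setoid; module ≡-Reasoning)

open ≡-Reasoning

T-injective : ∀ {x y} → (T x ⇔ T y) → x ≡ y
T-injective x⇔y = ⇔→≡ (⇔.trans (⇔.sym T-≡) (⇔.trans x⇔y T-≡))

module _ {A : Set} where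

  any-cong : ∀ {p q : A → Bool} → (∀ x → p x ≡ q x) → ∀ xs → any p xs ≡ any q xs
  any-cong p≗q xs = cong or (map-cong p≗q xs)

  any-false : ∀ (xs : List A) → any (λ _ → false) xs ≡ false
  any-false []       = refl
  any-false (_ ∷ xs) = any-false xs

  any-∨ : ∀ (p q : A → Bool) xs → any (λ x → p x ∨ q x) xs ≡ any p xs ∨ any q xs
  any-∨ p q []       = refl
  any-∨ p q (x ∷ xs) =
    trans (cong ((p x ∨ q x) ∨_) (any-∨ p q xs)) (interchange (p x) (q x) (any p xs) (any q xs))

  ∧-distribˡ-any : ∀ b (p : A → Bool) xs → b ∧ any p xs ≡ any (λ x → b ∧ p x) xs
  ∧-distribˡ-any b p []       = ∧-zeroʳ b
  ∧-distribˡ-any b p (x ∷ xs) =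
    trans (∧-distribˡ-∨ b (p x) (any p xs)) (cong (b ∧ p x ∨_) (∧-distribˡ-any b p xs))

  ∧-distribʳ-any : ∀ b (p : A → Bool) xs → any p xs ∧ b ≡ any (λ x → p x ∧ b) xs
  ∧-distribʳ-any b p []       = refl
  ∧-distribʳ-any b p (x ∷ xs) =
    trans (∧-distribʳ-∨ b (p x) (any p xs)) (cong (p x ∧ b ∨_) (∧-distribʳ-any b p xs))

  any-select : (_≟ᴬ_ : DecidableEquality A) (p : A → Bool) {x : A} {xs : List A} →
               x ∈ xs → any (λ y → p y ∧ ⌊ x ≟ᴬ y ⌋) xs ≡ p x
  any-select _≟ᴬ_ p {x} {xs} x∈xs = T-injective (mk⇔ select pick)
    where
    select : T (any (λ y → p y ∧ ⌊ x ≟ᴬ y ⌋) xs) → T (p x)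
    select hit with Any.satisfied (any⁻ _ xs hit)
    ... | y , py∧x≟y with Equivalence.to T-∧ py∧x≟y
    ...   | py , x≟y = subst (T ∘ p) (sym (toWitness {a? = x ≟ᴬ y} x≟y)) py

    pick : T (p x) → T (any (λ y → p y ∧ ⌊ x ≟ᴬ y ⌋) xs)
    pick px = any⁺ _ (Any.map (λ { refl → Equivalence.from T-∧ (px , fromWitness {a? = x ≟ᴬ x} refl) }) x∈xs)

module _ {A B : Set} where

  any-swap : ∀ (r : A → B → Bool) xs ys →
             any (λ x → any (r x) ys) xs ≡ any (λ y → any (λ x → r x y) xs) ys
  any-swap r []       ys = sym (any-false ys)
  any-swap r (x ∷ xs) ys = begin
    any (r x) ys ∨ any (λ x → any (r x) ys) xs
      ≡⟨ cong (any (r x) ys ∨_) (any-swap r xs ys) ⟩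
    any (r x) ys ∨ any (λ y → any (λ x → r x y) xs) ys
      ≡⟨ any-∨ (r x) (λ y → any (λ x → r x y) xs) ys ⟨
    any (λ y → r x y ∨ any (λ x → r x y) xs) ys
      ∎

  any-∧-factor : ∀ (e : B → Bool) (r : A → B → Bool) (c : A → Bool) xs ys →
                 any (λ x → any (λ y → e y ∧ r x y) ys ∧ c x) xs
                   ≡ any (λ y → e y ∧ any (λ x → r x y ∧ c x) xs) ys
  any-∧-factor e r c xs ys = begin
    any (λ x → any (λ y → e y ∧ r x y) ys ∧ c x) xs
      ≡⟨ any-cong (λ x → ∧-distribʳ-any (c x) (λ y → e y ∧ r x y) ys) xs ⟩
    any (λ x → any (λ y → (e y ∧ r x y) ∧ c x) ys) xs
      ≡⟨ any-swap (λ x y → (e y ∧ r x y) ∧ c x) xs ys ⟩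
    any (λ y → any (λ x → (e y ∧ r x y) ∧ c x) xs) ys
      ≡⟨ any-cong (λ y → any-cong (λ x → ∧-assoc (e y) (r x y) (c x)) xs) ys ⟩
    any (λ y → any (λ x → e y ∧ (r x y ∧ c x)) xs) ys
      ≡⟨ any-cong (λ y → ∧-distribˡ-any (e y) (λ x → r x y ∧ c x) xs) ys ⟨
    any (λ y → e y ∧ any (λ x → r x y ∧ c x) xs) ys
      ∎

Unique-++⁻ : ∀ {A : Set} (xs : List A) {ys : List A} →
             Unique (xs ++ ys) → Unique xs × Unique ys × Disjoint xs ys
Unique-++⁻ []       xs++ys! = [] , xs++ys! , λ ()
Unique-++⁻ (x ∷ xs) {ys} (x∉ ∷ xs++ys!) with Unique-++⁻ xs xs++ys!
... | xs! , ys! , xs#ys = All.++⁻ˡ xs x∉ ∷ xs! , ys! , x∷xs#ys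
  where
  x∷xs#ys : Disjoint (x ∷ xs) ys
  x∷xs#ys (here refl , x∈ys) = lookup (All.++⁻ʳ xs x∉) x∈ys refl
  x∷xs#ys (there v∈xs , v∈ys) = xs#ys (v∈xs , v∈ys)

vars-subtree⊆ : ∀ {n} {u : VTree n} (p : Pos u) → vars (subtree p) ⊆ vars u
vars-subtree⊆ here          = id
vars-subtree⊆ (left p)      = ∈-++⁺ˡ ∘ vars-subtree⊆ p
vars-subtree⊆ (right {l} p) = ∈-++⁺ʳ (vars l) ∘ vars-subtree⊆ p

subcircuit : ∀ {n} {u : VTree n} → Circ u → (p : Pos u) → Circ (subtree p)
subcircuit C                 here      = C
subcircuit (nd cl _ _ _ _ _) (left p)  = subcircuit cl p
subcircuit (nd _ cr _ _ _ _) (right p) = subcircuit cr p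

orGates : ∀ {n} {u : VTree n} → Circ u → ℕ
orGates (lf _ _ _)        = 0
orGates (nd _ _ _ no _ _) = no

orGate : ∀ {n} {u : VTree n} (C : Circ u) → Fin (orGates C) → Top C
orGate (nd _ _ _ _ _ _) g = g

orGates-subcircuit≤width : ∀ {n} {u : VTree n} (C : Circ u) (p : Pos u) →
                           orGates (subcircuit C p) ≤ width C
orGates-subcircuit≤width (lf _ _ _)          here      = z≤n
orGates-subcircuit≤width (nd _ _ _ no _ _)   here      = m≤m⊔n no _
orGates-subcircuit≤width (nd cl cr _ no _ _) (left p)  =
  m≤n⇒m≤o⊔n no (m≤n⇒m≤n⊔o (width cr) (orGates-subcircuit≤width cl p))
orGates-subcircuit≤width (nd cl cr _ no _ _) (right p) =
  m≤n⇒m≤o⊔n no (m≤n⇒m≤o⊔n (width cl) (orGates-subcircuit≤width cr p))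

-- context C p h g: the value of gate h once the ∨-gate g at node p is replaced by 1
-- and the other ∨-gates at p by 0.
context : ∀ {n} {u : VTree n} (C : Circ u) (p : Pos u) →
          Top C → Fin (orGates (subcircuit C p)) → BoolFun n
context (nd _ _ _ _ _ _) here h g a = ⌊ h ≟ g ⌋
context (nd cl cr _ _ andIn orIn) (left p) h g a =
  any (λ i → context cl p (proj₁ (andIn i)) g a ∧ eval cr a (proj₂ (andIn i))) (orIn h)
context (nd cl cr _ _ andIn orIn) (right p) h g a =
  any (λ i → context cr p (proj₂ (andIn i)) g a ∧ eval cl a (proj₁ (andIn i))) (orIn h)

eval-decompose : ∀ {n} {u : VTree n} (C : Circ u) (p : Pos u) → Internal (subtree p) →
                 ∀ a h → eval C a h ≡
                   any (λ g → eval (subcircuit C p) a (orGate _ g) ∧ context C p h g a)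
                       (allFin (orGates (subcircuit C p)))
eval-decompose C@(nd _ _ _ _ _ _) here _ a h = sym (any-select _≟_ (eval C a) (∈-allFin h))
eval-decompose (nd cl cr _ _ andIn orIn) (left p) p-internal a h = begin
  any (λ i → eval cl a (proj₁ (andIn i)) ∧ eval cr a (proj₂ (andIn i))) (orIn h)
    ≡⟨ any-cong (λ i → cong (_∧ eval cr a (proj₂ (andIn i)))
                            (eval-decompose cl p p-internal a (proj₁ (andIn i)))) (orIn h) ⟩
  any (λ i → any (λ g → at-p g ∧ context cl p (proj₁ (andIn i)) g a) (allFin _)
             ∧ eval cr a (proj₂ (andIn i))) (orIn h)
    ≡⟨ any-∧-factor at-p (λ i g → context cl p (proj₁ (andIn i)) g a)
                    (λ i → eval cr a (proj₂ (andIn i))) (orIn h) (allFin _) ⟩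
  any (λ g → at-p g ∧ any (λ i → context cl p (proj₁ (andIn i)) g a
                                 ∧ eval cr a (proj₂ (andIn i))) (orIn h)) (allFin _)
    ∎
  where
  at-p : Fin (orGates (subcircuit cl p)) → Bool
  at-p g = eval (subcircuit cl p) a (orGate _ g)
eval-decompose (nd cl cr _ _ andIn orIn) (right p) p-internal a h = begin
  any (λ i → eval cl a (proj₁ (andIn i)) ∧ eval cr a (proj₂ (andIn i))) (orIn h)
    ≡⟨ any-cong (λ i → ∧-comm (eval cl a (proj₁ (andIn i))) _) (orIn h) ⟩
  any (λ i → eval cr a (proj₂ (andIn i)) ∧ eval cl a (proj₁ (andIn i))) (orIn h)
    ≡⟨ any-cong (λ i → cong (_∧ eval cl a (proj₁ (andIn i)))
                            (eval-decompose cr p p-internal a (proj₂ (andIn i)))) (orIn h) ⟩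
  any (λ i → any (λ g → at-p g ∧ context cr p (proj₂ (andIn i)) g a) (allFin _)
             ∧ eval cl a (proj₁ (andIn i))) (orIn h)
    ≡⟨ any-∧-factor at-p (λ i g → context cr p (proj₂ (andIn i)) g a)
                    (λ i → eval cl a (proj₁ (andIn i))) (orIn h) (allFin _) ⟩
  any (λ g → at-p g ∧ any (λ i → context cr p (proj₂ (andIn i)) g a
                                 ∧ eval cl a (proj₁ (andIn i))) (orIn h)) (allFin _)
    ∎
  where
  at-p : Fin (orGates (subcircuit cr p)) → Bool
  at-p g = eval (subcircuit cr p) a (orGate _ g)

eval-dependsOnly : ∀ {n} {u : VTree n} (C : Circ u) (h : Top C) →
                   DependsOnly (_∈ vars u) (λ a → eval C a h)
eval-dependsOnly (lf x _ _) (true  , _) a a' a≈a' = a≈a' x (here refl)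
eval-dependsOnly (lf x _ _) (false , _) a a' a≈a' = cong not (a≈a' x (here refl))
eval-dependsOnly (nd {l} cl cr _ _ andIn orIn) h a a' a≈a' =
  any-cong (λ i → cong₂ _∧_ (eval-dependsOnly cl (proj₁ (andIn i)) a a' (λ x → a≈a' x ∘ ∈-++⁺ˡ))
                            (eval-dependsOnly cr (proj₂ (andIn i)) a a' (λ x → a≈a' x ∘ ∈-++⁺ʳ (vars l))))
           (orIn h)

context-dependsOnly : ∀ {n} {u : VTree n} → Unique (vars u) → (C : Circ u) (p : Pos u) →
                      ∀ h g → DependsOnly (Compl (VarsAt p)) (context C p h g)
context-dependsOnly _ (nd _ _ _ _ _ _) here h g a a' _ = refl
context-dependsOnly {u = node l r} u! (nd cl cr _ _ andIn orIn) (left p) h g a a' a≈a'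
  with Unique-++⁻ (vars l) u!
... | l! , _ , l#r =
  any-cong (λ i → cong₂ _∧_ (context-dependsOnly l! cl p (proj₁ (andIn i)) g a a' a≈a')
                            (eval-dependsOnly cr (proj₂ (andIn i)) a a'
                               (λ x x∈r → a≈a' x (λ x∈p → l#r (vars-subtree⊆ p x∈p , x∈r)))))
           (orIn h)
context-dependsOnly {u = node l r} u! (nd cl cr _ _ andIn orIn) (right p) h g a a' a≈a'
  with Unique-++⁻ (vars l) u!
... | _ , r! , l#r =
  any-cong (λ i → cong₂ _∧_ (context-dependsOnly r! cr p (proj₂ (andIn i)) g a a' a≈a')
                            (eval-dependsOnly cl (proj₁ (andIn i)) a a'
                               (λ x x∈l → a≈a' x (λ x∈p → l#r (x∈l , vars-subtree⊆ p x∈p)))))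
           (orIn h)

-- The output need not be an ∨-gate: the decomposition holds at every top gate.
proposition1 : ∀ {n : ℕ} (T : VTree n) → vars T ↭ allFin n
    → (D : Circ T) (out : Top D) → IsOr D out
    → (f : BoolFun n) → (∀ (a : Assignment n) → eval D a out ≡ f a)
    → (t : Pos T) → Internal (subtree t)
    → ∃[ s ] (s ≤ width D × RectCover f (VarsAt t) s)
proposition1 {n} T vars↭allFin D out _ f D≡f t t-internal =
  orGates (subcircuit D t) , orGates-subcircuit≤width D t , record
    { r₁     = λ g a → eval (subcircuit D t) a (orGate _ g)
    ; r₂     = context D t out
    ; r₁-onY = λ g → eval-dependsOnly (subcircuit D t) (orGate _ g)
    ; r₂-onZ = context-dependsOnly vars! D t out
    ; covers = λ a → trans (sym (D≡f a)) (eval-decompose D t t-internal a out)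
    }
  where
  vars! : Unique (vars T)
  vars! = Permutation.Unique-resp-↭ (setoid (Fin n)) (↭⇒↭ₛ (↭-sym vars↭allFin)) (allFin⁺ n)
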